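{- Let $x$ be an integer and $c,k,u_1,u_2,\lambda$ positive integers. Let $A$ be the $(\lambda+1)\times(k+3)$ integer matrix with rows indexed by $j=0,1,\dots,\lambda$ whose row $j$ is $$\Big(\tbinom{c+u_1}{j}+x\,\delta_{j,0},\ \tbinom{c+u_2}{j},\ \tbinom{c+k}{j},\ \tbinom{c+k-1}{j},\ \dots,\ \tbinom{c}{j}\Big),$$ where $\delta_{j,0}=1$ if $j=0$ and $0$ otherwise (so row $0$ is $(1+x,1,1,\dots,1)$). Let $A'$ be the $(\lambda+1)\times(k+3)$ matrix whose row $j$ ($j=0,\dots,\lambda$) is $$\Big(\tbinom{u_1}{j}+(-1)^j x\tbinom{j+c-1}{j},\ \tbinom{u_2}{j},\ \tbinom{k}{j},\ \tbinom{k-1}{j},\ \dots,\ \tbinom{0}{j}\Big).$$ Then $A'$ can be obtained from $A$ by a finite sequence of elementary row operations, each consisting of adding an integer multiple of one row to another row.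
   Context: $\binom{a}{b}$ denotes the usual binomial coefficient for nonnegative integers, with $\binom{a}{b}=0$ when $b>a$. -}

module Defs where

open import Data.Nat using (ℕ; zero; suc; _∸_) renaming (_+_ to _+ℕ_)
open import Data.Nat.Combinatorics using (_C_)
open import Data.Integer using (ℤ; +_; -[1+_]; _+_; _*_; _^_)
open import Data.Fin using (Fin; zero; suc; toℕ; _≟_)
open import Data.Product using (Σ; _×_)
open import Relation.Nullary using (¬_; yes; no)
open import Relation.Binary.PropositionalEquality using (_≡_)
open import Relation.Binary.Construct.Closure.ReflexiveTransitive using (Star)

Matrix : ℕ → ℕ → Set
Matrix m n = Fin m → Fin n → ℤ

addRowMul : ∀ {m n} → Fin m → Fin m → ℤ → Matrix m n → Matrix m n
addRowMul i j a M r col with r ≟ j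
... | yes _ = M j col + a * M i col
... | no _  = M r col

RowStep : ∀ {m n} → Matrix m n → Matrix m n → Set
RowStep {m} {n} M N =
  Σ (Fin m) λ i → Σ (Fin m) λ j → Σ ℤ λ a →
    (¬ i ≡ j) × (∀ r col → N r col ≡ addRowMul i j a M r col)

RowReachable : ∀ {m n} → Matrix m n → Matrix m n → Set
RowReachable = Star RowStep

δ0 : ℕ → ℤ
δ0 zero = + 1
δ0 (suc _) = + 0

matA : (x : ℤ) (c k u₁ u₂ l : ℕ) → Matrix (suc l) (3 +ℕ k)
matA x c k u₁ u₂ l r zero = + ((c +ℕ u₁) C toℕ r) + x * δ0 (toℕ r)
matA x c k u₁ u₂ l r (suc zero) = + ((c +ℕ u₂) C toℕ r)
matA x c k u₁ u₂ l r (suc (suc t)) = + (((c +ℕ k) ∸ toℕ t) C toℕ r)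

matA' : (x : ℤ) (c k u₁ u₂ l : ℕ) → Matrix (suc l) (3 +ℕ k)
matA' x c k u₁ u₂ l r zero =
  + (u₁ C toℕ r) + (-[1+ 0 ] ^ toℕ r) * x * + (((toℕ r +ℕ c) ∸ 1) C toℕ r)
matA' x c k u₁ u₂ l r (suc zero) = + (u₂ C toℕ r)
matA' x c k u₁ u₂ l r (suc (suc t)) = + ((k ∸ toℕ t) C toℕ r)

{-# OPTIONS --safe #-}
module Submission where

-- Read each column as the coefficient sequence of a power series in t. The columns of A are
-- (1 + t)^(c + u₁) + x, (1 + t)^(c + u₂), (1 + t)^(c + k), …, (1 + t)^c, and those of A' are the
-- same series divided by (1 + t)^c, since (1 + t)^-c = Σ (-1)^j C(j + c - 1, j) t^j. Dividing every
-- column by 1 + t is a sequence of row operations: going down the rows, once row j holds the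
-- quotient coefficient q_j, subtracting it from row j + 1 = q_j + q_(j+1) leaves q_(j+1).
-- Repeating this c times turns A into A'.

open import Defs
open import Data.Nat using (ℕ; zero; suc; _≤_; _<_; _∸_; _≤?_; z≤n; s≤s) renaming (_+_ to _+ℕ_)
import Data.Nat.Properties as ℕ
open import Data.Nat.Combinatorics using (_C_; k>n⇒nCk≡0; nCk+nC[k+1]≡[n+1]C[k+1])
open import Data.Integer using (ℤ; +_; _+_; _*_; _^_; -1ℤ; 0ℤ)
open import Data.Integer.Properties using (pos-+; *-zeroʳ; *-zeroˡ; +-identityʳ; *-assoc; *-comm)
open import Data.Integer.Tactic.RingSolver using (solve-∀)
open import Data.Fin using (Fin; zero; suc; toℕ; fromℕ<; _≟_)
open import Data.Fin.Properties using (toℕ-fromℕ<; toℕ-injective; toℕ≤pred[n])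
open import Data.Product using (_,_)
open import Relation.Nullary using (¬_; yes; no)
open import Relation.Nullary.Negation using (contradiction)
open import Relation.Binary.PropositionalEquality
open import Relation.Binary.Construct.Closure.ReflexiveTransitive using (ε; _◅_; _◅◅_)

_≈_ : ∀ {m n} → Matrix m n → Matrix m n → Set
M ≈ N = ∀ r col → M r col ≡ N r col

rowStep : ∀ {m n} {M N : Matrix m n} (i j : Fin m) (a : ℤ) → ¬ i ≡ j →
  (∀ col → N j col ≡ M j col + a * M i col) →
  (∀ r → ¬ r ≡ j → ∀ col → N r col ≡ M r col) →
  RowStep M N
rowStep {M = M} {N} i j a i≢j target others = i , j , a , i≢j , agrees
  where
  agrees : ∀ r col → N r col ≡ addRowMul i j a M r col
  agrees r col with r ≟ j
  ... | yes refl = target col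
  ... | no r≢j = others r r≢j col

-- Without function extensionality pointwise equal matrices need not be equal,
-- so they are related by adding 0 times a row, which needs a second row.
≈⇒RowReachable : ∀ {l n} {M N : Matrix (suc (suc l)) n} → M ≈ N → RowReachable M N
≈⇒RowReachable {M = M} {N} M≈N = rowStep zero (suc zero) 0ℤ (λ ()) add-zero (λ r _ col → sym (M≈N r col)) ◅ ε
  where
  add-zero : ∀ col → N (suc zero) col ≡ M (suc zero) col + 0ℤ * M zero col
  add-zero col = begin
    N (suc zero) col                      ≡⟨ M≈N (suc zero) col ⟨
    M (suc zero) col                      ≡⟨ +-identityʳ (M (suc zero) col) ⟨
    M (suc zero) col + 0ℤ                 ≡⟨ cong (λ z → M (suc zero) col + z) (*-zeroˡ (M zero col)) ⟨
    M (suc zero) col + 0ℤ * M zero col    ∎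
    where open ≡-Reasoning

Series : Set
Series = ℕ → ℤ

fromColumns : ∀ {m n} → (Fin n → Series) → Matrix m n
fromColumns S r col = S col (toℕ r)

mul[1+t] : Series → Series
mul[1+t] g zero = g zero
mul[1+t] g (suc j) = g j + g (suc j)

splice : ℕ → Series → Series → Series
splice t g f j with j ≤? t
... | yes _ = g j
... | no _ = f j

splice-≤ : ∀ {t j} (g f : Series) → j ≤ t → splice t g f j ≡ g j
splice-≤ {t} {j} g f j≤t with j ≤? t
... | yes _ = refl
... | no j≰t = contradiction j≤t j≰t

splice-> : ∀ {t j} (g f : Series) → t < j → splice t g f j ≡ f j
splice-> {t} {j} g f t<j with j ≤? t
... | yes j≤t = contradiction j≤t (ℕ.<⇒≱ t<j)
... | no _ = refl

splice-suc : ∀ {t j} (g f : Series) → ¬ j ≡ suc t → splice (suc t) g f j ≡ splice t g f j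
splice-suc {t} {j} g f j≢t+1 with j ≤? t
... | yes j≤t = splice-≤ g f (ℕ.m≤n⇒m≤1+n j≤t)
... | no j≰t = splice-> g f t+1<j
  where
  t+1<j : suc t < j
  t+1<j = ℕ.≤∧≢⇒< (ℕ.≰⇒> j≰t) (λ t+1≡j → j≢t+1 (sym t+1≡j))

module Sweep {l n : ℕ} (S T : Fin n → Series) (S≗[1+t]T : ∀ col → S col ≗ mul[1+t] (T col)) where

  sweptTo : ℕ → Matrix (suc l) n
  sweptTo t = fromColumns (λ col → splice t (T col) (S col))

  sweep-step : ∀ {t} → t < l → RowStep (sweptTo t) (sweptTo (suc t))
  sweep-step {t} t<l = rowStep i j -1ℤ i≢j target others
    where
    i j : Fin (suc l)
    i = fromℕ< (ℕ.m<n⇒m<1+n t<l)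
    j = fromℕ< (s≤s t<l)

    i≡t : toℕ i ≡ t
    i≡t = toℕ-fromℕ< (ℕ.m<n⇒m<1+n t<l)

    j≡t+1 : toℕ j ≡ suc t
    j≡t+1 = toℕ-fromℕ< (s≤s t<l)

    i≢j : ¬ i ≡ j
    i≢j i≡j = ℕ.<⇒≢ (ℕ.n<1+n t) (trans (sym i≡t) (trans (cong toℕ i≡j) j≡t+1))

    target : ∀ col → sweptTo (suc t) j col ≡ sweptTo t j col + -1ℤ * sweptTo t i col
    target col = begin
      sweptTo (suc t) j col                    ≡⟨ splice-≤ g f (ℕ.≤-reflexive j≡t+1) ⟩
      g (toℕ j)                                ≡⟨ cong g j≡t+1 ⟩
      g (suc t)                                ≡⟨ cancel (g t) (g (suc t)) ⟨
      (g t + g (suc t)) + -1ℤ * g t            ≡⟨ cong (λ a → a + -1ℤ * g t) (S≗[1+t]T col (suc t)) ⟨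
      f (suc t) + -1ℤ * g t                    ≡⟨ cong₂ (λ a b → a + -1ℤ * b) row-j row-i ⟨
      sweptTo t j col + -1ℤ * sweptTo t i col  ∎
      where
      open ≡-Reasoning
      g f : Series
      g = T col
      f = S col
      cancel : ∀ a b → (a + b) + -1ℤ * a ≡ b
      cancel = solve-∀
      row-j : sweptTo t j col ≡ f (suc t)
      row-j = trans (splice-> g f (subst (t <_) (sym j≡t+1) (ℕ.n<1+n t))) (cong f j≡t+1)
      row-i : sweptTo t i col ≡ g t
      row-i = trans (splice-≤ g f (ℕ.≤-reflexive i≡t)) (cong g i≡t)

    others : ∀ r → ¬ r ≡ j → ∀ col → sweptTo (suc t) r col ≡ sweptTo t r col
    others r r≢j col = splice-suc (T col) (S col) (λ r≡t+1 → r≢j (toℕ-injective (trans r≡t+1 (sym j≡t+1))))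

  sweep-chain : ∀ t → t ≤ l → RowReachable (sweptTo 0) (sweptTo t)
  sweep-chain zero _ = ε
  sweep-chain (suc t) t<l = sweep-chain t (ℕ.<⇒≤ t<l) ◅◅ sweep-step t<l ◅ ε

divide[1+t] : ∀ {l n} (S T : Fin n → Series) → (∀ col → S col ≗ mul[1+t] (T col)) →
  RowReachable {suc (suc l)} (fromColumns S) (fromColumns T)
divide[1+t] {l} S T S≗[1+t]T =
  ≈⇒RowReachable start ◅◅ sweep-chain (suc l) ℕ.≤-refl ◅◅ ≈⇒RowReachable finish
  where
  open Sweep {suc l} S T S≗[1+t]T

  start : fromColumns S ≈ sweptTo 0
  start zero col = trans (S≗[1+t]T col 0) (sym (splice-≤ {0} (T col) (S col) z≤n))
  start (suc r) col = sym (splice-> (T col) (S col) (s≤s z≤n))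

  finish : sweptTo (suc l) ≈ fromColumns T
  finish r col = splice-≤ (T col) (S col) (toℕ≤pred[n] r)

mul[1+t]-lincomb : ∀ {f g h k : Series} (x : ℤ) → f ≗ mul[1+t] g → h ≗ mul[1+t] k →
  (λ j → f j + x * h j) ≗ mul[1+t] (λ j → g j + x * k j)
mul[1+t]-lincomb x f≗ h≗ zero = cong₂ (λ a b → a + x * b) (f≗ zero) (h≗ zero)
mul[1+t]-lincomb {g = g} {k = k} x f≗ h≗ (suc j) =
  trans (cong₂ (λ a b → a + x * b) (f≗ (suc j)) (h≗ (suc j))) (regroup x (g j) (g (suc j)) (k j) (k (suc j)))
  where
  regroup : ∀ y a b c d → (a + b) + y * (c + d) ≡ (a + y * c) + (b + y * d)
  regroup = solve-∀

binom : ℕ → Series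
binom n j = + (n C j)

binom-suc : ∀ n → binom (suc n) ≗ mul[1+t] (binom n)
binom-suc n zero = refl
binom-suc n (suc j) = trans (cong +_ (sym (nCk+nC[k+1]≡[n+1]C[k+1] n j))) (pos-+ (n C j) (n C suc j))

-- Coefficients of (1 + t) ^ -d; the truncated subtraction makes negBinom 0 the unit series.
negBinom : ℕ → Series
negBinom d j = -1ℤ ^ j * + (((j +ℕ d) ∸ 1) C j)

negBinom-zero : negBinom 0 ≗ δ0
negBinom-zero zero = refl
negBinom-zero (suc j) = trans (cong (λ z → -1ℤ ^ suc j * + z) (k>n⇒nCk≡0 j+0<1+j)) (*-zeroʳ (-1ℤ ^ suc j))
  where
  j+0<1+j : j +ℕ 0 < suc j
  j+0<1+j = s≤s (ℕ.≤-reflexive (ℕ.+-identityʳ j))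

negBinom-suc : ∀ d → negBinom d ≗ mul[1+t] (negBinom (suc d))
negBinom-suc d zero = refl
negBinom-suc d (suc j) rewrite ℕ.+-suc j d = begin
  -1ℤ * s * binom n (suc j)
    ≡⟨ signed-pascal s (binom n j) (binom n (suc j)) ⟩
  s * binom n j + -1ℤ * s * (binom n j + binom n (suc j))
    ≡⟨ cong (λ z → s * binom n j + -1ℤ * s * z) (binom-suc n (suc j)) ⟨
  s * binom n j + -1ℤ * s * binom (suc n) (suc j)
    ∎
  where
  open ≡-Reasoning
  n : ℕ
  n = j +ℕ d
  s : ℤ
  s = -1ℤ ^ j
  signed-pascal : ∀ s a b → -1ℤ * s * b ≡ s * a + -1ℤ * s * (a + b)
  signed-pascal = solve-∀

module Columns (x : ℤ) (k u₁ u₂ : ℕ) where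

  columns : ℕ → ℕ → Fin (3 +ℕ k) → Series
  columns e d zero j = binom (e +ℕ u₁) j + x * negBinom d j
  columns e d (suc zero) j = binom (e +ℕ u₂) j
  columns e d (suc (suc t)) j = binom (e +ℕ (k ∸ toℕ t)) j

  columns-suc : ∀ e d col → columns (suc e) d col ≗ mul[1+t] (columns e (suc d) col)
  columns-suc e d zero = mul[1+t]-lincomb x (binom-suc (e +ℕ u₁)) (negBinom-suc d)
  columns-suc e d (suc zero) = binom-suc (e +ℕ u₂)
  columns-suc e d (suc (suc t)) = binom-suc (e +ℕ (k ∸ toℕ t))

  columns-reachable : ∀ {l} e d →
    RowReachable {suc (suc l)} (fromColumns (columns e d)) (fromColumns (columns 0 (e +ℕ d)))
  columns-reachable zero d = ε
  columns-reachable {l} (suc e) d =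
    divide[1+t] (columns (suc e) d) (columns e (suc d)) (columns-suc e d)
      ◅◅ subst (λ d′ → RowReachable {suc (suc l)} (fromColumns (columns e (suc d))) (fromColumns (columns 0 d′)))
               (ℕ.+-suc e d) (columns-reachable e (suc d))

  matA≈columns : ∀ c l → matA x c k u₁ u₂ l ≈ fromColumns (columns c 0)
  matA≈columns c l r zero = cong (λ z → binom (c +ℕ u₁) (toℕ r) + x * z) (sym (negBinom-zero (toℕ r)))
  matA≈columns c l r (suc zero) = refl
  matA≈columns c l r (suc (suc t)) = cong (λ n → binom n (toℕ r)) (ℕ.+-∸-assoc c (toℕ≤pred[n] t))

  columns≈matA′ : ∀ c l → fromColumns (columns 0 (c +ℕ 0)) ≈ matA' x c k u₁ u₂ l
  columns≈matA′ c l r zero rewrite ℕ.+-identityʳ c =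
    cong (λ z → binom u₁ (toℕ r) + z) (trans (sym (*-assoc x s b)) (cong (_* b) (*-comm x s)))
    where
    s b : ℤ
    s = -1ℤ ^ toℕ r
    b = binom ((toℕ r +ℕ c) ∸ 1) (toℕ r)
  columns≈matA′ c l r (suc zero) = refl
  columns≈matA′ c l r (suc (suc t)) = refl

mainTheorem8 : (x : ℤ) (c k u₁ u₂ l : ℕ) →
    1 ≤ c → 1 ≤ k → 1 ≤ u₁ → 1 ≤ u₂ → 1 ≤ l →
    RowReachable (matA x c k u₁ u₂ l) (matA' x c k u₁ u₂ l)
mainTheorem8 x c k u₁ u₂ (suc l) _ _ _ _ (s≤s z≤n) =
  ≈⇒RowReachable (matA≈columns c (suc l))
    ◅◅ columns-reachable c 0
    ◅◅ ≈⇒RowReachable (columns≈matA′ c (suc l))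
  where open Columns x k u₁ u₂
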